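{- Let $\mathcal{H}$ be a pseudohalfplane hypergraph on a vertex set $V$ with $|V|=n\ge 3$, with witnessing ABA-free hypergraph $\mathcal{F}$. Then the set of extremal vertices of $\mathcal{H}$ contains at least $3$ vertices.
   Context: Let $V$ be a finite totally ordered set. A hypergraph $\mathcal{F}$ on $V$ is ABA-free if there are no two hyperedges $A,B\in\mathcal{F}$ and vertices $x<y<z$ with $x,z\in A\setminus B$ and $y\in B\setminus A$. Let $\bar{\mathcal{F}}=\{V\setminus F: F\in\mathcal{F}\}$. $\mathcal{H}$ is a pseudohalfplane hypergraph if $\mathcal{H}\subseteq\mathcal{F}\cup\bar{\mathcal{F}}$ for some ABA-free $\mathcal{F}$ on $V$; fix such an $\mathcal{F}$. A vertex $a$ is skippable in a hypergraph $\mathcal{G}$ on $V$ if some $A\in\mathcal{G}$ has $\min(A)<a<\max(A)$ and $a\notin A$, and unskippable otherwise. The topvertices are the unskippable vertices of $\mathcal{F}$, the bottomvertices are the unskippable vertices of $\bar{\mathcal{F}}$, and the extremal vertices of $\mathcal{H}$ (with respect to $\mathcal{F}$) are the vertices that are topvertices or bottomvertices. -}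

module Defs where

open import Data.Nat using (ℕ)
open import Data.Fin using (Fin; _<_)
open import Data.Fin.Subset using (Subset; _∈_; _∉_; ∁)
open import Data.List using (List; map)
open import Data.List.Membership.Propositional using () renaming (_∈_ to _∈ₗ_)
open import Data.Empty using (⊥)
open import Data.Product using (∃; _×_)
open import Data.Sum using (_⊎_)
open import Relation.Nullary using (¬_)

-- The vertex set V is Fin n with its natural total order.
-- A hypergraph on V is a finite list of hyperedges, each a subset of V.
Hypergraph : ℕ → Set
Hypergraph n = List (Subset n)

ABAFree : ∀ {n} → Hypergraph n → Set
ABAFree {n} F =
  ∀ (A B : Subset n) → A ∈ₗ F → B ∈ₗ F →
  ∀ (x y z : Fin n) → x < y → y < z →
  x ∈ A → x ∉ B → z ∈ A → z ∉ B → y ∈ B → y ∉ A → ⊥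

complementFamily : ∀ {n} → Hypergraph n → Hypergraph n
complementFamily F = map ∁ F

_⊆F∪F̄_ : ∀ {n} → Hypergraph n → Hypergraph n → Set
_⊆F∪F̄_ {n} H F = ∀ (A : Subset n) → A ∈ₗ H → (A ∈ₗ F) ⊎ (A ∈ₗ complementFamily F)

-- a is skippable in G: some A ∈ G has min(A) < a < max(A) and a ∉ A.
-- (min(A) < a < max(A) is written out as: A has an element below a and one above a.)
Skippable : ∀ {n} → Hypergraph n → Fin n → Set
Skippable {n} G a =
  ∃ λ (A : Subset n) → A ∈ₗ G × a ∉ A ×
    (∃ λ (x : Fin n) → x ∈ A × x < a) × (∃ λ (z : Fin n) → z ∈ A × a < z)

Unskippable : ∀ {n} → Hypergraph n → Fin n → Set
Unskippable G a = ¬ Skippable G a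

Topvertex : ∀ {n} → Hypergraph n → Fin n → Set
Topvertex F a = Unskippable F a

Bottomvertex : ∀ {n} → Hypergraph n → Fin n → Set
Bottomvertex F a = Unskippable (complementFamily F) a

Extremal : ∀ {n} → Hypergraph n → Fin n → Set
Extremal F a = Topvertex F a ⊎ Bottomvertex F a

{-# OPTIONS --safe #-}
-- The first and the last vertex can never be skipped, so they are topvertices; it
-- remains to rule out that every interior vertex is skipped both in F and in F̄.
-- ABA-freeness lets one slide the left end of a skipping hyperedge down to the first
-- vertex o: if A₁ skips w starting at o and A skips v starting at w, then o ∈ A, or
-- A₁ itself skips v, or A skips v starting strictly between w and v.  So the
-- penultimate vertex is skipped between the first and the last vertex both by some
-- A ∈ F and by the complement of some B ∈ F, an ABA pattern for A and B.
module Submission where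

open import Defs
open import Data.Nat using (ℕ; _≤_)
open import Data.Fin using (Fin)
open import Data.Product using (∃; _×_)
open import Relation.Binary.PropositionalEquality using (_≢_)

open import Data.Nat using (suc; s≤s; s<s; z<s; s<s⁻¹)
import Data.Nat.Properties as ℕ
open import Data.Fin using (zero; suc; fromℕ; inject₁; _<_; _>_)
open import Data.Fin.Properties using (_<?_; <-trans; <⇒≢; ≤fromℕ; <-cmp)
import Data.Fin.Properties as Fin
open import Data.Fin.Induction using (<-wellFounded; >-wellFounded; Acc; acc)
open import Data.Fin.Subset using (Subset; _∈_; _∉_; ∁)
open import Data.Fin.Subset.Properties using (_∈?_; x∈∁p⇒x∉p; x∉∁p⇒x∈p)
open import Data.List using (map)
open import Data.List.Relation.Unary.Any using (any?)
open import Data.List.Membership.Propositional using (find; lose) renaming (_∈_ to _∈ₗ_)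
open import Data.List.Membership.Propositional.Properties using (∈-map⁻)
open import Data.Product using (_,_; proj₁; proj₂)
open import Data.Sum using (_⊎_; inj₁; inj₂)
open import Data.Empty using (⊥; ⊥-elim)
open import Function using (_∘_)
open import Relation.Binary.Definitions using (tri<; tri≈; tri>)
open import Relation.Nullary using (Dec; yes; no)
open import Relation.Nullary.Decidable using (¬?; _×-dec_; _⊎-dec_; map′; decidable-stable)
open import Relation.Binary.PropositionalEquality using (_≡_; refl; cong; subst)

SkippedBetween : ∀ {n} → Hypergraph n → Fin n → Fin n → Fin n → Set
SkippedBetween {n} G x z v = ∃ λ (A : Subset n) → A ∈ₗ G × x ∈ A × z ∈ A × v ∉ A

SkippedFrom : ∀ {n} → Hypergraph n → Fin n → Fin n → Set
SkippedFrom G x v = ∃ λ z → v < z × SkippedBetween G x z v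

skippable⇒skippedFrom : ∀ {n} {G : Hypergraph n} {v} →
  Skippable G v → ∃ λ x → x < v × SkippedFrom G x v
skippable⇒skippedFrom (A , A∈ , v∉A , (x , x∈A , x<v) , (z , z∈A , v<z)) =
  x , x<v , z , v<z , A , A∈ , x∈A , z∈A , v∉A

skippable? : ∀ {n} (G : Hypergraph n) (v : Fin n) → Dec (Skippable G v)
skippable? G v = map′ find (λ (_ , A∈ , p) → lose A∈ p) (any? skips? G)
  where
  skips? : (A : Subset _) →
    Dec (v ∉ A × (∃ λ x → x ∈ A × x < v) × (∃ λ z → z ∈ A × v < z))
  skips? A = ¬? (v ∈? A)
    ×-dec Fin.any? (λ x → x ∈? A ×-dec x <? v)
    ×-dec Fin.any? (λ z → z ∈? A ×-dec v <? z)

extremal? : ∀ {n} (F : Hypergraph n) (v : Fin n) → Dec (Extremal F v)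
extremal? F v = ¬? (skippable? F v) ⊎-dec ¬? (skippable? (complementFamily F) v)

zero-unskippable : ∀ {n} (G : Hypergraph (suc n)) → Unskippable G zero
zero-unskippable G (_ , _ , _ , (_ , _ , ()) , _)

fromℕ-unskippable : ∀ {n} (G : Hypergraph (suc n)) → Unskippable G (fromℕ n)
fromℕ-unskippable G (_ , _ , _ , _ , (z , _ , last<z)) = ℕ.≤⇒≯ (≤fromℕ z) last<z

abaFree-∁ : ∀ {n} {F : Hypergraph n} → ABAFree F → ABAFree (complementFamily F)
abaFree-∁ aba A′ B′ A′∈ B′∈ x y z x<y y<z x∈A′ x∉B′ z∈A′ z∉B′ y∈B′ y∉A′
  with ∈-map⁻ ∁ A′∈ | ∈-map⁻ ∁ B′∈
... | A , A∈ , refl | B , B∈ , refl =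
  aba B A B∈ A∈ x y z x<y y<z (x∉∁p⇒x∈p x∉B′) (x∈∁p⇒x∉p x∈A′)
      (x∉∁p⇒x∈p z∉B′) (x∈∁p⇒x∉p z∈A′) (x∉∁p⇒x∈p y∉A′) (x∈∁p⇒x∉p y∈B′)

skippedBetween-∁-⊥ : ∀ {n} {F : Hypergraph n} {x z v} → ABAFree F → x < v → v < z →
  SkippedBetween F x z v → SkippedBetween (complementFamily F) x z v → ⊥
skippedBetween-∁-⊥ aba x<v v<z (A , A∈ , x∈A , z∈A , v∉A) (C , C∈ , x∈C , z∈C , v∉C)
  with ∈-map⁻ ∁ C∈
... | B , B∈ , refl =
  aba A B A∈ B∈ _ _ _ x<v v<z x∈A (x∈∁p⇒x∉p x∈C) z∈A (x∈∁p⇒x∉p z∈C) (x∉∁p⇒x∈p v∉C) v∉A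

module _ {n} {G : Hypergraph n} (aba : ABAFree G) where

  skippedFrom-shift : ∀ {o w v} → o < w → w < v → SkippedFrom G o w → SkippedFrom G w v →
    SkippedFrom G o v ⊎ ∃ λ x → w < x × x < v × SkippedFrom G x v
  skippedFrom-shift {o} {w} {v} o<w w<v (z₁ , w<z₁ , A₁ , A₁∈ , o∈A₁ , z₁∈A₁ , w∉A₁)
                                         (z , v<z , A , A∈ , w∈A , z∈A , v∉A)
    with o ∈? A
  ... | yes o∈A = inj₁ (z , v<z , A , A∈ , o∈A , z∈A , v∉A)
  -- Now o ∈ A₁ ∖ A and w ∈ A ∖ A₁, so no vertex beyond w lies in A₁ ∖ A.
  ... | no o∉A with v ∈? A₁
  ...   | yes v∈A₁ = ⊥-elim (aba A₁ A A₁∈ A∈ o w v o<w w<v o∈A₁ o∉A v∈A₁ v∉A w∈A w∉A₁)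
  ...   | no v∉A₁ with <-cmp v z₁
  ...     | tri< v<z₁ _ _ = inj₁ (z₁ , v<z₁ , A₁ , A₁∈ , o∈A₁ , z₁∈A₁ , v∉A₁)
  ...     | tri≈ _ refl _ = ⊥-elim (v∉A₁ z₁∈A₁)
  ...     | tri> _ _ z₁<v with z₁ ∈? A
  ...       | yes z₁∈A = inj₂ (z₁ , w<z₁ , z₁<v , z , v<z , A , A∈ , z₁∈A , z∈A , v∉A)
  ...       | no z₁∉A = ⊥-elim (aba A₁ A A₁∈ A∈ o w z₁ o<w w<z₁ o∈A₁ o∉A z₁∈A₁ z₁∉A w∈A w∉A₁)

  skippedFrom-pull : ∀ {o x v} → (∀ {w} → o < w → w < v → SkippedFrom G o w) →
    o < x → x < v → SkippedFrom G x v → SkippedFrom G o v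
  skippedFrom-pull {o} {x} {v} below = go (>-wellFounded x)
    where
    go : ∀ {x} → Acc _>_ x → o < x → x < v → SkippedFrom G x v → SkippedFrom G o v
    go (acc rec) o<x x<v s with skippedFrom-shift o<x x<v (below o<x x<v) s
    ... | inj₁ s₀ = s₀
    ... | inj₂ (y , x<y , y<v , s′) = go (rec x<y) (<-trans o<x x<y) y<v s′

skippedFrom-zero : ∀ {n} {G : Hypergraph (suc n)} {t : Fin (suc n)} → ABAFree G →
  (∀ {v} → zero {n} < v → v < t → Skippable G v) →
  ∀ {v} → zero {n} < v → v < t → SkippedFrom G zero v
skippedFrom-zero {n} {G} {t} aba skip = go (<-wellFounded _)
  where
  go : ∀ {v} → Acc _<_ v → zero {n} < v → v < t → SkippedFrom G zero v
  go (acc rec) 0<v v<t with skippable⇒skippedFrom (skip 0<v v<t)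
  ... | zero , _ , s = s
  ... | suc _ , x<v , s =
    skippedFrom-pull aba (λ 0<w w<v → go (rec w<v) 0<w (<-trans w<v v<t)) z<s x<v s

inject₁-fromℕ<fromℕ : ∀ k → inject₁ (fromℕ k) < fromℕ (suc k)
inject₁-fromℕ<fromℕ 0 = z<s
inject₁-fromℕ<fromℕ (suc k) = s<s (inject₁-fromℕ<fromℕ k)

inject₁-fromℕ<⇒≡fromℕ : ∀ {k} {z : Fin (suc (suc k))} → inject₁ (fromℕ k) < z → z ≡ fromℕ (suc k)
inject₁-fromℕ<⇒≡fromℕ {0} {suc zero} _ = refl
inject₁-fromℕ<⇒≡fromℕ {suc k} {suc z} p<z = cong suc (inject₁-fromℕ<⇒≡fromℕ (s<s⁻¹ p<z))

skippedFrom-penultimate : ∀ {k} {G : Hypergraph (suc (suc k))} {x} →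
  SkippedFrom G x (inject₁ (fromℕ k)) → SkippedBetween G x (fromℕ (suc k)) (inject₁ (fromℕ k))
skippedFrom-penultimate {G = G} {x} (z , p<z , s) =
  subst (λ z → SkippedBetween G x z _) (inject₁-fromℕ<⇒≡fromℕ p<z) s

interior-skippable-⊥ : ∀ {m} {F : Hypergraph (suc (suc (suc m)))} → ABAFree F →
  (∀ {v} → zero {suc (suc m)} < v → v < fromℕ (suc (suc m)) →
     Skippable F v × Skippable (complementFamily F) v) → ⊥
interior-skippable-⊥ {m} aba skip =
  skippedBetween-∁-⊥ aba z<s p<last
    (skippedFrom-penultimate (skippedFrom-zero aba (λ 0<v v<t → proj₁ (skip 0<v v<t)) z<s p<last))
    (skippedFrom-penultimate (skippedFrom-zero (abaFree-∁ aba) (λ 0<v v<t → proj₂ (skip 0<v v<t)) z<s p<last))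
  where
  p<last : inject₁ (fromℕ (suc m)) < fromℕ (suc (suc m))
  p<last = inject₁-fromℕ<fromℕ (suc m)

-- Extremality only refers to F.
mainTheorem15 : ∀ (n : ℕ) → 3 ≤ n → (F H : Hypergraph n) → ABAFree F → H ⊆F∪F̄ F →
    ∃ λ (a : Fin n) → ∃ λ (b : Fin n) → ∃ λ (c : Fin n) →
      a ≢ b × a ≢ c × b ≢ c × Extremal F a × Extremal F b × Extremal F c
mainTheorem15 (suc (suc (suc m))) (s≤s (s≤s (s≤s _))) F _ aba _
  with Fin.any? (λ v → zero {suc (suc m)} <? v ×-dec v <? fromℕ _ ×-dec extremal? F v)
... | yes (v , 0<v , v<last , ext) =
  zero , v , fromℕ _ , <⇒≢ 0<v , (λ ()) , <⇒≢ v<last ,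
  inj₁ (zero-unskippable F) , ext , inj₁ (fromℕ-unskippable F)
... | no none = ⊥-elim (interior-skippable-⊥ aba λ 0<v v<last →
  decidable-stable (skippable? F _) (none ∘ λ u → _ , 0<v , v<last , inj₁ u) ,
  decidable-stable (skippable? (complementFamily F) _) (none ∘ λ u → _ , 0<v , v<last , inj₂ u))
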